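{- Let $g:B\to A$, $h:C\to A$, $p:D\to B$ and $q:D\to C$ be covers with $g\circ p=h\circ q$. Assume there is a cover $f$ with $f\sqsubseteq g$, $f\sqsubseteq h$ and $|{\rm Hom}(h,f)|=\deg f$. Then there exists a unique map $\phi:{\rm Hom}(g,f)\to{\rm Hom}(h,f)$ such that $\phi(k)\circ q=k\circ p$ for all $k\in{\rm Hom}(g,f)$. Moreover $\phi$ is injective.
   Context: Let $\mathbf C$ be a category and $\mathbf D$ a full subcategory of $\mathbf C$. For arrows $f,g$ of $\mathbf C$ with ${\rm cod}\,f={\rm cod}\,g$, ${\rm Hom}(g,f)$ denotes the collection of all arrows $h$ of $\mathbf C$ with $g=f\circ h$. Standing assumptions: (G1) every diagram $B\to A\leftarrow C$ in $\mathbf D$ has a pullback in $\mathbf C$. (G2) (I) pushouts exist in $\mathbf D$; (II) every arrow of $\mathbf D$ is epic; (III) every monic arrow of $\mathbf D$ is an isomorphism whose inverse is an arrow of $\mathbf D$. (G3) for every object $U$ of $\mathbf C$ there is a set $\Sigma(U)$ of arrows $i$ of $\mathbf C$ with ${\rm dom}\,i$ in $\mathbf D$ and ${\rm cod}\,i=U$ such that for every arrow $u$ of $\mathbf C$ with ${\rm dom}\,u$ in $\mathbf D$ and ${\rm cod}\,u=U$ there is exactly one $i\in\Sigma(U)$ with ${\rm Hom}(u,i)\neq\emptyset$. (G4) there is a function $\deg$ from the collection of arrows of $\mathbf C$ whose codomain lies in $\mathbf D$ to the positive integers such that (I) $\deg(g\circ f)=\deg g\cdot\deg f$ whenever $f,g,g\circ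 f$ all lie in this collection; (II) $\deg f=\sum_{i\in\Sigma({\rm dom}\,f)}\deg(f\circ i)$ for every such $f$; (III) if $B\xrightarrow{f}A\xleftarrow{g}C$ is a diagram in $\mathbf D$ with pullback $B\xleftarrow{p}U\xrightarrow{q}C$, then $\deg f=\deg q$ and $\deg g=\deg p$. A cover is an arrow of $\mathbf D$. Write $f\sqsubseteq g$ if ${\rm cod}\,f={\rm cod}\,g$ and ${\rm Hom}(g,f)\neq\emptyset$. -}

module Defs where

open import Level using (Level; _⊔_; suc)
open import Data.Nat using (ℕ; zero; _+_; _*_; _>_)
open import Data.Fin using (Fin)
import Data.Fin as F
open import Data.Product using (Σ; ∃; _×_; _,_; proj₁)
open import Function.Bundles using (_↔_; Inverse)
open import Relation.Binary.PropositionalEquality using (_≡_)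

sumFin : (n : ℕ) → (Fin n → ℕ) → ℕ
sumFin zero    a = 0
sumFin (ℕ.suc n) a = a F.zero + sumFin n (λ i → a (F.suc i))

record Category (o ℓ : Level) : Set (suc (o ⊔ ℓ)) where
  infixr 9 _∘_
  infix 4 _⇒_
  field
    Obj : Set o
    _⇒_ : Obj → Obj → Set ℓ
    id  : ∀ {A} → A ⇒ A
    _∘_ : ∀ {A B C} → B ⇒ C → A ⇒ B → A ⇒ C
    identityˡ : ∀ {A B} (f : A ⇒ B) → id ∘ f ≡ f
    identityʳ : ∀ {A B} (f : A ⇒ B) → f ∘ id ≡ f
    assoc : ∀ {A B C D} (f : A ⇒ B) (g : B ⇒ C) (h : C ⇒ D) →
            (h ∘ g) ∘ f ≡ h ∘ (g ∘ f)

module CatNotions {o ℓ : Level} (𝐂 : Category o ℓ) where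
  open Category 𝐂

  HomOver : ∀ {B E A} → B ⇒ A → E ⇒ A → Set ℓ
  HomOver {B} {E} g f = Σ (B ⇒ E) (λ h → g ≡ f ∘ h)

  _⊑_ : ∀ {E B A} → E ⇒ A → B ⇒ A → Set ℓ
  f ⊑ g = HomOver g f

  HasCard : ∀ {B E A} → B ⇒ A → E ⇒ A → ℕ → Set ℓ
  HasCard {B} {E} g f n =
    Σ (Fin n → B ⇒ E) λ e →
      (∀ i → g ≡ f ∘ e i) ×
      (∀ i j → e i ≡ e j → i ≡ j) ×
      (∀ k → g ≡ f ∘ k → Σ (Fin n) λ i → e i ≡ k)

  IsPullback : ∀ {A B C U} → B ⇒ A → C ⇒ A → U ⇒ B → U ⇒ C → Set (o ⊔ ℓ)
  IsPullback {A} {B} {C} {U} f g p q =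
    (f ∘ p ≡ g ∘ q) ×
    (∀ {X} (p′ : X ⇒ B) (q′ : X ⇒ C) → f ∘ p′ ≡ g ∘ q′ →
      Σ (X ⇒ U) λ u → (p ∘ u ≡ p′) × (q ∘ u ≡ q′) ×
        (∀ u′ → p ∘ u′ ≡ p′ → q ∘ u′ ≡ q′ → u′ ≡ u))

-- The standing assumptions (G1)-(G4) for a category C and a full
-- subcategory D (given by the predicate InD on objects).
record Setting (o ℓ d s : Level) : Set (suc (o ⊔ ℓ ⊔ d ⊔ s)) where
  field
    𝐂   : Category o ℓ
  open Category 𝐂
  open CatNotions 𝐂
  field
    InD : Obj → Set d
    G1 : ∀ {A B C} → InD A → InD B → InD C → (f : B ⇒ A) (g : C ⇒ A) →
         Σ Obj λ U → Σ (U ⇒ B) λ p → Σ (U ⇒ C) λ q → IsPullback f g p q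
    G2-I : ∀ {A B C} → InD A → InD B → InD C → (f : A ⇒ B) (g : A ⇒ C) →
           Σ Obj λ P → InD P × Σ (B ⇒ P) λ i₁ → Σ (C ⇒ P) λ i₂ →
             (i₁ ∘ f ≡ i₂ ∘ g) ×
             (∀ {Z} → InD Z → (u : B ⇒ Z) (v : C ⇒ Z) → u ∘ f ≡ v ∘ g →
               Σ (P ⇒ Z) λ w → (w ∘ i₁ ≡ u) × (w ∘ i₂ ≡ v) ×
                 (∀ w′ → w′ ∘ i₁ ≡ u → w′ ∘ i₂ ≡ v → w′ ≡ w))
    G2-II : ∀ {A B} → InD A → InD B → (f : A ⇒ B) →
            ∀ {Z} → InD Z → (u v : B ⇒ Z) → u ∘ f ≡ v ∘ f → u ≡ v
    -- (G2)(III) every monic arrow of D is an isomorphism (inverse lies in D as D is full)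
    G2-III : ∀ {A B} → InD A → InD B → (f : A ⇒ B) →
             (∀ {Z} → InD Z → (u v : Z ⇒ A) → f ∘ u ≡ f ∘ v → u ≡ v) →
             Σ (B ⇒ A) λ g → (g ∘ f ≡ id) × (f ∘ g ≡ id)
    -- (G3) the sets Σ(U), given as families indexed by Idx U
    Idx    : Obj → Set s
    ΣDom   : ∀ {U} → Idx U → Obj
    ΣDomD  : ∀ {U} (j : Idx U) → InD (ΣDom j)
    ΣArr   : ∀ {U} (j : Idx U) → ΣDom j ⇒ U
    G3 : ∀ {U X} → InD X → (u : X ⇒ U) →
         Σ (Idx U) λ j → HomOver u (ΣArr j) ×
           (∀ j′ → HomOver u (ΣArr j′) → j′ ≡ j)
    -- (G4) the degree, meaningful on arrows whose codomain lies in D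
    deg : ∀ {X A} → X ⇒ A → ℕ
    deg-pos : ∀ {X A} → InD A → (f : X ⇒ A) → deg f > 0
    G4-I : ∀ {X Y Z} → InD Y → InD Z → (f : X ⇒ Y) (g : Y ⇒ Z) →
           deg (g ∘ f) ≡ deg g * deg f
    G4-II : ∀ {U A} → InD A → (f : U ⇒ A) →
            Σ ℕ λ n → Σ (Fin n ↔ Idx U) λ e →
              deg f ≡ sumFin n (λ i → deg (f ∘ ΣArr (Inverse.to e i)))
    G4-III : ∀ {A B C U} → InD A → InD B → InD C →
             (f : B ⇒ A) (g : C ⇒ A) (p : U ⇒ B) (q : U ⇒ C) →
             IsPullback f g p q → (deg f ≡ deg q) × (deg g ≡ deg p)

{-# OPTIONS --safe #-}
-- Pull f back along h to U → C. Each of the deg f arrows e ∈ Hom(h,f) gives a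
-- section of U → C, and a section lying in a connected component of U (an
-- element of Σ(U)) is by (G2)(III) an isomorphism onto that component, so distinct
-- sections lie in distinct components. Since deg(U → C) = deg f is a sum of
-- |Σ(U)| positive terms, the sections exhaust the components. The arrow D → U
-- induced by k ∘ p and q therefore factors as a section e composed with q, which
-- gives φ(k) = e; uniqueness and injectivity of φ follow because q and p are epic.
module Submission where

open import Defs
open import Data.Empty using (⊥-elim)
open import Data.Fin using (Fin; zero; suc; _≟_)
open import Data.Fin.Properties using (any?; injective⇒≤)
import Data.Nat as ℕ
open import Data.Nat using (ℕ; _≤_; _<_; z≤n)
open import Data.Nat.Properties using (+-mono-≤; ≤-trans; ≤-reflexive; 1+n≰n)
open import Data.Product using (Σ; ∃; _×_; _,_; proj₁; proj₂)
open import Data.Vec.Functional using (_∷_)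
open import Function.Bundles using (_↔_; Inverse; Injection)
open import Function.Definitions using (Injective; StrictlySurjective)
open import Function.Properties.Inverse using (↔-sym; ↔⇒↣)
open import Relation.Binary.PropositionalEquality
  using (_≡_; refl; sym; trans; cong; subst; module ≡-Reasoning)
open import Relation.Nullary using (yes; no)

n≤sumFin : ∀ n (a : Fin n → ℕ) → (∀ i → 0 < a i) → n ≤ sumFin n a
n≤sumFin ℕ.zero    a a>0 = z≤n
n≤sumFin (ℕ.suc n) a a>0 =
  +-mono-≤ (a>0 zero) (n≤sumFin n (λ i → a (suc i)) (λ i → a>0 (suc i)))

injective⇒strictlySurjective : ∀ {m n} {e : Fin m → Fin n} →
  n ≤ m → Injective _≡_ _≡_ e → StrictlySurjective _≡_ e
injective⇒strictlySurjective {e = e} n≤m e-injective y with any? (λ x → e x ≟ y)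
... | yes hit = hit
... | no miss = ⊥-elim (1+n≰n (≤-trans (injective⇒≤ y∷e-injective) n≤m))
  where
  y∷e-injective : Injective _≡_ _≡_ (y ∷ e)
  y∷e-injective {zero}  {zero}   _     = refl
  y∷e-injective {zero}  {suc x′} y≡ex′ = ⊥-elim (miss (x′ , sym y≡ex′))
  y∷e-injective {suc x} {zero}   ex≡y  = ⊥-elim (miss (x , ex≡y))
  y∷e-injective {suc x} {suc x′} ex≡ex′ = cong suc (e-injective ex≡ex′)

↔Fin-injective⇒strictlySurjective : ∀ {a} {X : Set a} {m n} → Fin n ↔ X →
  {e : Fin m → X} → n ≤ m → Injective _≡_ _≡_ e → StrictlySurjective _≡_ e
↔Fin-injective⇒strictlySurjective enum n≤m e-injective x =
  let j , from-ej≡from-x =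
        injective⇒strictlySurjective n≤m (λ eq → e-injective (from-injective eq)) (from x)
  in j , from-injective from-ej≡from-x
  where
  open Inverse enum using (from)
  open Injection (↔⇒↣ (↔-sym enum)) renaming (injective to from-injective)

module CategoryProperties {o ℓ} (𝐂 : Category o ℓ) where
  open Category 𝐂
  open ≡-Reasoning

  split-mono⇒mono : ∀ {X Y Z} {t : X ⇒ Y} {r : Y ⇒ X} → r ∘ t ≡ id →
    (u v : Z ⇒ X) → t ∘ u ≡ t ∘ v → u ≡ v
  split-mono⇒mono {t = t} {r} r∘t≡id u v t∘u≡t∘v = begin
    u             ≡⟨ sym (identityˡ u) ⟩
    id ∘ u        ≡⟨ cong (_∘ u) (sym r∘t≡id) ⟩
    (r ∘ t) ∘ u   ≡⟨ assoc u t r ⟩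
    r ∘ (t ∘ u)   ≡⟨ cong (r ∘_) t∘u≡t∘v ⟩
    r ∘ (t ∘ v)   ≡⟨ sym (assoc v t r) ⟩
    (r ∘ t) ∘ v   ≡⟨ cong (_∘ v) r∘t≡id ⟩
    id ∘ v        ≡⟨ identityˡ v ⟩
    v             ∎

  retraction⇒rightInverse : ∀ {X Y} {t : X ⇒ Y} {r t′ : Y ⇒ X} →
    r ∘ t ≡ id → t ∘ t′ ≡ id → t ∘ r ≡ id
  retraction⇒rightInverse {t = t} {r} {t′} r∘t≡id t∘t′≡id = begin
    t ∘ r                ≡⟨ cong (t ∘_) (sym (identityʳ r)) ⟩
    t ∘ (r ∘ id)         ≡⟨ cong (λ y → t ∘ (r ∘ y)) (sym t∘t′≡id) ⟩
    t ∘ (r ∘ (t ∘ t′))   ≡⟨ cong (t ∘_) (sym (assoc t′ t r)) ⟩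
    t ∘ ((r ∘ t) ∘ t′)   ≡⟨ cong (λ y → t ∘ (y ∘ t′)) r∘t≡id ⟩
    t ∘ (id ∘ t′)        ≡⟨ cong (t ∘_) (identityˡ t′) ⟩
    t ∘ t′               ≡⟨ t∘t′≡id ⟩
    id                   ∎

module SettingProperties {o ℓ d s} (S : Setting o ℓ d s) where
  open Setting S
  open Category 𝐂
  open CatNotions 𝐂
  open CategoryProperties 𝐂
  open ≡-Reasoning

  split-mono⇒iso : ∀ {X Y} → InD X → InD Y → {t : X ⇒ Y} {r : Y ⇒ X} →
    r ∘ t ≡ id → t ∘ r ≡ id
  split-mono⇒iso dX dY {t} r∘t≡id =
    retraction⇒rightInverse r∘t≡id
      (proj₂ (proj₂ (G2-III dX dY t (λ _ → split-mono⇒mono r∘t≡id))))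

  -- If a section s of π factors through a : Z ⇒ U, then a = s ∘ π ∘ a by (G2)(III),
  -- so every arrow through a is fixed by the idempotent s ∘ π.
  section-absorbs : ∀ {C U Z} → InD C → InD Z → {π : U ⇒ C} {s : C ⇒ U} →
    π ∘ s ≡ id → {a : Z ⇒ U} → HomOver s a →
    ∀ {X} {x : X ⇒ U} → HomOver x a → x ≡ s ∘ (π ∘ x)
  section-absorbs dC dZ {π} {s} π∘s≡id {a} (t , s≡a∘t) {x = x} (w , x≡a∘w) = begin
    x                    ≡⟨ x≡a∘w ⟩
    a ∘ w                ≡⟨ cong (_∘ w) a≡s∘π∘a ⟩
    (s ∘ (π ∘ a)) ∘ w    ≡⟨ assoc w (π ∘ a) s ⟩
    s ∘ ((π ∘ a) ∘ w)    ≡⟨ cong (s ∘_) (assoc w a π) ⟩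
    s ∘ (π ∘ (a ∘ w))    ≡⟨ cong (λ y → s ∘ (π ∘ y)) (sym x≡a∘w) ⟩
    s ∘ (π ∘ x)          ∎
    where
    π∘a∘t≡id : (π ∘ a) ∘ t ≡ id
    π∘a∘t≡id = trans (assoc t a π) (trans (cong (π ∘_) (sym s≡a∘t)) π∘s≡id)

    a≡s∘π∘a : a ≡ s ∘ (π ∘ a)
    a≡s∘π∘a = begin
      a                    ≡⟨ sym (identityʳ a) ⟩
      a ∘ id               ≡⟨ cong (a ∘_) (sym (split-mono⇒iso dC dZ π∘a∘t≡id)) ⟩
      a ∘ (t ∘ (π ∘ a))    ≡⟨ sym (assoc (π ∘ a) t a) ⟩
      (a ∘ t) ∘ (π ∘ a)    ≡⟨ cong (_∘ (π ∘ a)) (sym s≡a∘t) ⟩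
      s ∘ (π ∘ a)          ∎

  Idx-count≤deg : ∀ {U A} (dA : InD A) (f : U ⇒ A) → proj₁ (G4-II dA f) ≤ deg f
  Idx-count≤deg dA f with G4-II dA f
  ... | n , _ , deg≡sum = subst (n ≤_) (sym deg≡sum) (n≤sumFin n _ (λ _ → deg-pos dA _))

  module PullbackSections {A C E} (dA : InD A) (dC : InD C) (dE : InD E)
    (f : E ⇒ A) (h : C ⇒ A) (card : HasCard h f (deg f)) where

    e : Fin (deg f) → C ⇒ E
    e = proj₁ card

    e∈Hom : ∀ j → h ≡ f ∘ e j
    e∈Hom = proj₁ (proj₂ card)

    e-injective : ∀ i j → e i ≡ e j → i ≡ j
    e-injective = proj₁ (proj₂ (proj₂ card))

    U : Obj
    U = proj₁ (G1 dA dE dC f h)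

    π₁ : U ⇒ E
    π₁ = proj₁ (proj₂ (G1 dA dE dC f h))

    π₂ : U ⇒ C
    π₂ = proj₁ (proj₂ (proj₂ (G1 dA dE dC f h)))

    isPullback : IsPullback f h π₁ π₂
    isPullback = proj₂ (proj₂ (proj₂ (G1 dA dE dC f h)))

    section : Fin (deg f) → C ⇒ U
    section j = proj₁ (proj₂ isPullback (e j) id (trans (sym (e∈Hom j)) (sym (identityʳ h))))

    π₁∘section : ∀ j → π₁ ∘ section j ≡ e j
    π₁∘section j =
      proj₁ (proj₂ (proj₂ isPullback (e j) id (trans (sym (e∈Hom j)) (sym (identityʳ h)))))

    π₂∘section : ∀ j → π₂ ∘ section j ≡ id
    π₂∘section j =
      proj₁ (proj₂ (proj₂ (proj₂ isPullback (e j) id (trans (sym (e∈Hom j)) (sym (identityʳ h))))))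

    component : Fin (deg f) → Idx U
    component j = proj₁ (G3 dC (section j))

    section∈component : ∀ j → HomOver (section j) (ΣArr (component j))
    section∈component j = proj₁ (proj₂ (G3 dC (section j)))

    component-injective : Injective _≡_ _≡_ component
    component-injective {j} {j′} same = e-injective j j′ (begin
      e j                ≡⟨ sym (π₁∘section j) ⟩
      π₁ ∘ section j     ≡⟨ cong (π₁ ∘_) section-j≡section-j′ ⟩
      π₁ ∘ section j′    ≡⟨ π₁∘section j′ ⟩
      e j′               ∎)
      where
      section-j≡section-j′ : section j ≡ section j′
      section-j≡section-j′ = begin
        section j                      ≡⟨ section-absorbs dC (ΣDomD (component j)) (π₂∘section j′)
                                            (subst (λ i → HomOver (section j′) (ΣArr i)) (sym same)
                                              (section∈component j′))
                                            (section∈component j) ⟩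
        section j′ ∘ (π₂ ∘ section j)  ≡⟨ cong (section j′ ∘_) (π₂∘section j) ⟩
        section j′ ∘ id                ≡⟨ identityʳ (section j′) ⟩
        section j′                     ∎

    component-surjective : StrictlySurjective _≡_ component
    component-surjective =
      ↔Fin-injective⇒strictlySurjective (proj₁ (proj₂ (G4-II dC π₂)))
        (≤-trans (Idx-count≤deg dC π₂)
          (≤-reflexive (sym (proj₁ (G4-III dA dE dC f h π₁ π₂ isPullback)))))
        component-injective

    factors-through-section : ∀ {X} → InD X → (x : X ⇒ U) →
      ∃ λ j → x ≡ section j ∘ (π₂ ∘ x)
    factors-through-section dX x =
      let i , x∈i , _ = G3 dX x
          j , component-j≡i = component-surjective i
      in j , section-absorbs dC (ΣDomD i) (π₂∘section j)
               (subst (λ i′ → HomOver (section j) (ΣArr i′)) component-j≡i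
                 (section∈component j))
               x∈i

    lift : ∀ {B D} → InD D → {g : B ⇒ A} {p : D ⇒ B} {q : D ⇒ C} → g ∘ p ≡ h ∘ q →
      (k : HomOver g f) → Σ (HomOver h f) λ l → proj₁ l ∘ q ≡ proj₁ k ∘ p
    lift dD {g} {p} {q} g∘p≡h∘q (k , g≡f∘k) =
      let u , π₁∘u≡k∘p , π₂∘u≡q , _ = proj₂ isPullback (k ∘ p) q f∘k∘p≡h∘q
          j , u≡section∘π₂∘u = factors-through-section dD u
      in (e j , e∈Hom j) , (begin
        e j ∘ q                       ≡⟨ cong (_∘ q) (sym (π₁∘section j)) ⟩
        (π₁ ∘ section j) ∘ q          ≡⟨ assoc q (section j) π₁ ⟩
        π₁ ∘ (section j ∘ q)          ≡⟨ cong (λ y → π₁ ∘ (section j ∘ y)) (sym π₂∘u≡q) ⟩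
        π₁ ∘ (section j ∘ (π₂ ∘ u))   ≡⟨ cong (π₁ ∘_) (sym u≡section∘π₂∘u) ⟩
        π₁ ∘ u                        ≡⟨ π₁∘u≡k∘p ⟩
        k ∘ p                         ∎)
      where
      f∘k∘p≡h∘q : f ∘ (k ∘ p) ≡ h ∘ q
      f∘k∘p≡h∘q = trans (sym (assoc p k f)) (trans (cong (_∘ p) (sym g≡f∘k)) g∘p≡h∘q)

lemma3p17 : ∀ {o ℓ d s} (S : Setting o ℓ d s) →
    let open Setting S in
    let open Category 𝐂 in
    let open CatNotions 𝐂 in
    ∀ {A B C D E} → InD A → InD B → InD C → InD D → InD E →
    (g : B ⇒ A) (h : C ⇒ A) (p : D ⇒ B) (q : D ⇒ C) →
    g ∘ p ≡ h ∘ q →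
    (f : E ⇒ A) → f ⊑ g → f ⊑ h → HasCard h f (deg f) →
    Σ (HomOver g f → HomOver h f) λ φ →
      (∀ k → proj₁ (φ k) ∘ q ≡ proj₁ k ∘ p) ×
      (∀ (ψ : HomOver g f → HomOver h f) →
        (∀ k → proj₁ (ψ k) ∘ q ≡ proj₁ k ∘ p) →
        ∀ k → proj₁ (ψ k) ≡ proj₁ (φ k)) ×
      (∀ k k′ → proj₁ (φ k) ≡ proj₁ (φ k′) → proj₁ k ≡ proj₁ k′)
lemma3p17 S dA dB dC dD dE g h p q g∘p≡h∘q f _ _ card =
  φ , φ-commutes , φ-unique , φ-injective
  -- f ⊑ h follows from the cardinality hypothesis (deg f > 0).
  where
  open Setting S
  open Category 𝐂
  open CatNotions 𝐂
  open SettingProperties.PullbackSections S dA dC dE f h card using (lift)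

  φ : HomOver g f → HomOver h f
  φ k = proj₁ (lift dD g∘p≡h∘q k)

  φ-commutes : ∀ k → proj₁ (φ k) ∘ q ≡ proj₁ k ∘ p
  φ-commutes k = proj₂ (lift dD g∘p≡h∘q k)

  φ-unique : ∀ (ψ : HomOver g f → HomOver h f) → (∀ k → proj₁ (ψ k) ∘ q ≡ proj₁ k ∘ p) →
    ∀ k → proj₁ (ψ k) ≡ proj₁ (φ k)
  φ-unique ψ ψ-commutes k = G2-II dD dC q dE _ _ (trans (ψ-commutes k) (sym (φ-commutes k)))

  φ-injective : ∀ k k′ → proj₁ (φ k) ≡ proj₁ (φ k′) → proj₁ k ≡ proj₁ k′
  φ-injective k k′ same =
    G2-II dD dB p dE _ _ (trans (sym (φ-commutes k)) (trans (cong (_∘ q) same) (φ-commutes k′)))
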